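{- Let $n\ge2$ and consider the dihedral group $D_{2n}$. The only saturated subsets of $D_{2n}$ that contain an even power of $r$ and do not contain $e$ are the sets $\{r^{2k},r^{2l}\}$ with $r^{2k}\neq r^{2l}$, where $\frac{2n}{\gcd(2n,2k)}$ and $\frac{2n}{\gcd(2n,2l)}$ are even and $2$ appears with the same multiplicity in $2k$ and $2l$.
   Context: For $N\ge3$, $D_N$ is the group of order $2N$ generated by $r,f$ with relations $r^N=f^2=e$ and $fr=r^{ -1}f$; every element is uniquely $r^a$ or $fr^a$ with $a\in\mathbb{Z}/N\mathbb{Z}$. Here $N=2n$. For a group $S$, a subset $U\subseteq S$ is avoidable if there is a partition $\{A,B\}$ of $S$ such that no element of $U$ equals $xy$ with $x\neq y$ both in $A$ or both in $B$ (in either order). A subset is saturated if it is maximal with respect to inclusion among the avoidable subsets. -}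

module Defs where

open import Data.Nat using (ℕ; zero; suc; _+_; _*_; _∸_; _^_; _≤_; s≤s; z≤n; NonZero; ≢-nonZero; ≢-nonZero⁻¹; >-nonZero)
open import Data.Nat.Properties using (≤-trans; m≤m+n)
open import Data.Nat.DivMod using (_%_; _/_; m%n<n)
open import Data.Nat.Divisibility using (_∣_)
open import Data.Nat.GCD using (gcd; gcd[m,n]≢0)
open import Data.Fin using (Fin; toℕ; fromℕ<)
open import Data.Bool using (Bool; true; false)
open import Data.Product using (Σ; ∃; _×_; _,_)
open import Data.Sum using (_⊎_; inj₁)
open import Relation.Binary.PropositionalEquality using (_≡_; _≢_)
open import Relation.Nullary using (¬_)

-- Elements of the dihedral group D_N: rot a = r^a, ref a = f r^a  (a ∈ ℤ/Nℤ as Fin N).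
data Dih (N : ℕ) : Set where
  rot : Fin N → Dih N
  ref : Fin N → Dih N

nz : (n : ℕ) → 2 ≤ n → NonZero (2 * n)
nz n hn = >-nonZero (≤-trans (≤-trans (s≤s z≤n) hn) (m≤m+n n (1 * n)))

module _ (n : ℕ) (hn : 2 ≤ n) where

  private
    N : ℕ
    N = 2 * n
    instance
      nzN : NonZero N
      nzN = nz n hn

  D : Set
  D = Dih (2 * n)

  md : ℕ → Fin (2 * n)
  md x = fromℕ< (m%n<n x N)

  -- multiplication, from r^N = f^2 = e and f r = r^{-1} f:
  --   r^a r^b = r^{a+b},  r^a (f r^b) = f r^{b-a},  (f r^a) r^b = f r^{a+b},  (f r^a)(f r^b) = r^{b-a}
  mul : D → D → D
  mul (rot a) (rot b) = rot (md (toℕ a + toℕ b))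
  mul (rot a) (ref b) = ref (md (toℕ b + (N ∸ toℕ a)))
  mul (ref a) (rot b) = ref (md (toℕ a + toℕ b))
  mul (ref a) (ref b) = rot (md (toℕ b + (N ∸ toℕ a)))

  e : D
  e = rot (md 0)

  rpow : ℕ → D
  rpow k = rot (md k)

  SubsetD : Set
  SubsetD = D → Bool

  -- A partition {A,B} of D: A = {x | c x ≡ true}, B = {x | c x ≡ false}, both nonempty.
  -- U is avoided by the partition if no element of U is x·y with x ≠ y in the same block
  -- (quantifying over all x,y covers both orders).
  Avoidable : SubsetD → Set
  Avoidable U =
    Σ (D → Bool) λ c →
      (∃ λ a → c a ≡ true) × (∃ λ b → c b ≡ false) ×
      (∀ x y → x ≢ y → c x ≡ c y → U (mul x y) ≡ false)

  _⊆_ : SubsetD → SubsetD → Set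
  U ⊆ V = ∀ x → U x ≡ true → V x ≡ true

  Saturated : SubsetD → Set
  Saturated U = Avoidable U × (∀ V → Avoidable V → U ⊆ V → V ⊆ U)

  ordQuot : ℕ → ℕ
  ordQuot x = _/_ N (gcd N x) {{≢-nonZero (gcd[m,n]≢0 N x (inj₁ (≢-nonZero⁻¹ N)))}}

SameMult2 : ℕ → ℕ → Set
SameMult2 a b = ∀ j → ((2 ^ j ∣ a → 2 ^ j ∣ b) × (2 ^ j ∣ b → 2 ^ j ∣ a))

{-# OPTIONS --safe #-}
module Submission where

-- Let c be a 2-colouring avoiding U.  If r^m ∈ U with m ≢ 0, then (f r^x)(f r^(x+m)) = r^m forces
-- c(f r^(x+m)) = not c(f r^x): m is an antiperiod of x ↦ c(f r^x).  Two antiperiods with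
-- a·m₁ = b·m₂ force a ≡ b (mod 2); this excludes odd m, gives all antiperiods the same 2-adic
-- valuation and, as 2n is a period, even additive order.  Triangles of elements whose pairwise
-- products lie in U exclude reflections and a third even rotation, and if r^(2k) were the only
-- element then U ∪ {e} would still be avoidable.  Conversely {r^(2k), r^(2l)} is avoided by
-- colouring f r^x with the s-th binary digit of x, where 2^s exactly divides 2k, and r^a by a
-- proper 2-colouring of the graph on ℤ/2n joining a ≠ b when a + b ≡ 2k or 2l: its edges come
-- from two reflections of ℤ/2n, so it is a union of paths and even cycles.

open import Data.Bool using (Bool; true; false; not; _∧_; _∨_; _xor_; if_then_else_)
import Data.Bool as Bool
open import Data.Bool.Properties
  using (not-injective; not-distribˡ-xor; not-distribʳ-xor; xor-same; xor-comm; xor-identityʳ; ∧-zeroʳ; ∨-zeroʳ; ¬-not; not-¬)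
open import Data.Empty using (⊥)
open import Data.Fin using (Fin; toℕ)
import Data.Fin as Fin
open import Data.Fin.Properties using (toℕ-fromℕ<; toℕ-injective; toℕ<n; any?)
open import Data.Nat
open import Data.Nat.Coprimality using (Coprime; coprime-Bézout; coprime-/gcd)
import Data.Nat.Coprimality as Coprimality
open import Data.Nat.DivMod
open import Data.Nat.Divisibility
open import Data.Nat.GCD using (gcd; gcd[m,n]∣m; gcd[m,n]∣n; gcd[m,n]≢0; gcd-greatest; c*gcd[m,n]≡gcd[cm,cn]; module Bézout)
open import Data.Nat.Induction using (<-rec)
open import Data.Nat.Properties
open import Data.Nat.Tactic.RingSolver using (solve-∀)
open import Data.Product using (Σ; ∃; _×_; _,_; proj₁; proj₂)
open import Data.Sum using (_⊎_; inj₁; inj₂)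
import Data.Sum as Sum
open import Function using (_∘_; _on_)
open import Level using (0ℓ)
open import Relation.Binary.Bundles using (Setoid)
open import Relation.Binary.Core using (_Preserves_⟶_)
import Relation.Binary.Construct.On as On
open import Relation.Binary.Definitions using (DecidableEquality; tri<; tri≈; tri>)
open import Relation.Binary.PropositionalEquality
import Relation.Binary.Reasoning.Setoid as SetoidReasoning
open import Relation.Nullary using (¬_; contradiction; does; yes; no)
import Relation.Nullary.Decidable as Dec
open import Relation.Nullary.Decidable using (dec-true; dec-false; _×-dec_; ¬?)

open import Defs

-- Modular arithmetic

module ModularArithmetic (m : ℕ) .{{_ : NonZero m}} where

  infix 4 _≈_ _≉_
  _≈_ : ℕ → ℕ → Set
  _≈_ = _≡_ on (_% m)

  _≉_ : ℕ → ℕ → Set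
  a ≉ b = ¬ a ≈ b

  ≈-setoid : Setoid 0ℓ 0ℓ
  ≈-setoid = On.setoid (setoid ℕ) (_% m)

  open Setoid ≈-setoid public using () renaming (refl to ≈-refl; sym to ≈-sym; trans to ≈-trans)
  module ≈-Reasoning = SetoidReasoning ≈-setoid

  ≡⇒≈ : ∀ {a b} → a ≡ b → a ≈ b
  ≡⇒≈ = cong (_% m)

  %-≈ : ∀ a → a % m ≈ a
  %-≈ a = m%n%n≡m%n a m

  +-cong : ∀ {a b c d} → a ≈ b → c ≈ d → a + c ≈ b + d
  +-cong {a} {b} {c} {d} a≈b c≈d = begin
    (a + c) % m           ≡⟨ %-distribˡ-+ a c m ⟩
    (a % m + c % m) % m   ≡⟨ cong₂ (λ x y → (x + y) % m) a≈b c≈d ⟩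
    (b % m + d % m) % m   ≡⟨ %-distribˡ-+ b d m ⟨
    (b + d) % m           ∎
    where open ≡-Reasoning

  *-cong : ∀ {a b c d} → a ≈ b → c ≈ d → a * c ≈ b * d
  *-cong {a} {b} {c} {d} a≈b c≈d = begin
    (a * c) % m           ≡⟨ %-distribˡ-* a c m ⟩
    (a % m * (c % m)) % m ≡⟨ cong₂ (λ x y → (x * y) % m) a≈b c≈d ⟩
    (b % m * (d % m)) % m ≡⟨ %-distribˡ-* b d m ⟨
    (b * d) % m           ∎
    where open ≡-Reasoning

  +-congˡ : ∀ a {b c} → b ≈ c → a + b ≈ a + c
  +-congˡ a = +-cong {a} {a} refl

  +-congʳ : ∀ c {a b} → a ≈ b → a + c ≈ b + c
  +-congʳ c a≈b = +-cong a≈b (refl {x = c % m})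

  *-congˡ : ∀ a {b c} → b ≈ c → a * b ≈ a * c
  *-congˡ a = *-cong {a} {a} refl

  *-congʳ : ∀ c {a b} → a ≈ b → a * c ≈ b * c
  *-congʳ c a≈b = *-cong a≈b (refl {x = c % m})

  0%m≡0 : 0 % m ≡ 0
  0%m≡0 = m<n⇒m%n≡m (>-nonZero⁻¹ m)

  *m≈0 : ∀ k → k * m ≈ 0
  *m≈0 k = trans (m*n%n≡0 k m) (sym 0%m≡0)

  m≈0 : m ≈ 0
  m≈0 = trans (n%n≡0 m) (sym 0%m≡0)

  ≈0⇒∣ : ∀ {a} → a ≈ 0 → m ∣ a
  ≈0⇒∣ {a} a≈0 = m%n≡0⇒n∣m a m (trans a≈0 0%m≡0)

  ≈⇒≡ : ∀ {a b} → a < m → b < m → a ≈ b → a ≡ b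
  ≈⇒≡ a<m b<m a≈b = trans (sym (m<n⇒m%n≡m a<m)) (trans a≈b (m<n⇒m%n≡m b<m))

  %-divisor : ∀ {d a b} .{{_ : NonZero d}} → d ∣ m → a ≈ b → a % d ≡ b % d
  %-divisor {d} {a} {b} d∣m a≈b = begin
    a % d         ≡⟨ m∣n⇒o%n%m≡o%m d m a d∣m ⟨
    a % m % d     ≡⟨ cong (_% d) a≈b ⟩
    b % m % d     ≡⟨ m∣n⇒o%n%m≡o%m d m b d∣m ⟩
    b % d         ∎
    where open ≡-Reasoning

  neg : ℕ → ℕ
  neg a = m ∸ a % m

  +-inverseʳ : ∀ a → a + neg a ≈ 0
  +-inverseʳ a = begin
    a + (m ∸ a % m)       ≈⟨ +-congʳ (m ∸ a % m) (≈-sym (%-≈ a)) ⟩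
    a % m + (m ∸ a % m)   ≡⟨ m+[n∸m]≡n (m%n≤n a m) ⟩
    m                     ≈⟨ m≈0 ⟩
    0                     ∎
    where open ≈-Reasoning

  m+n-n≈m : ∀ a b → a + b + neg b ≈ a
  m+n-n≈m a b = begin
    a + b + neg b         ≡⟨ +-assoc a b (neg b) ⟩
    a + (b + neg b)       ≈⟨ +-congˡ a (+-inverseʳ b) ⟩
    a + 0                 ≡⟨ +-identityʳ a ⟩
    a                     ∎
    where open ≈-Reasoning

  m-n+n≈m : ∀ a b → a + neg b + b ≈ a
  m-n+n≈m a b = begin
    a + neg b + b         ≡⟨ +-assoc a (neg b) b ⟩
    a + (neg b + b)       ≡⟨ cong (a +_) (+-comm (neg b) b) ⟩
    a + (b + neg b)       ≡⟨ +-assoc a b (neg b) ⟨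
    a + b + neg b         ≈⟨ m+n-n≈m a b ⟩
    a                     ∎
    where open ≈-Reasoning

  m+n-m≈n : ∀ a b → a + b + neg a ≈ b
  m+n-m≈n a b = ≈-trans (≡⇒≈ (cong (_+ neg a) (+-comm a b))) (m+n-n≈m b a)

  m-n≈o⇒m≈n+o : ∀ {a b c} → b + neg a ≈ c → b ≈ a + c
  m-n≈o⇒m≈n+o {a} {b} {c} b-a≈c = begin
    b                     ≈⟨ m-n+n≈m b a ⟨
    b + neg a + a         ≈⟨ +-congʳ a b-a≈c ⟩
    c + a                 ≡⟨ +-comm c a ⟩
    a + c                 ∎
    where open ≈-Reasoning

  [m+n-o]+[m+o-n]≈2m : ∀ a b c → (a + b + neg c) + (a + c + neg b) ≈ 2 * a
  [m+n-o]+[m+o-n]≈2m a b c = begin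
    a + b + neg c + (a + c + neg b)     ≡⟨ regroup a b c (neg b) (neg c) ⟩
    2 * a + (b + neg b) + (c + neg c)   ≈⟨ +-cong (+-congˡ (2 * a) (+-inverseʳ b)) (+-inverseʳ c) ⟩
    2 * a + 0 + 0                       ≡⟨ cong (_+ 0) (+-identityʳ (2 * a)) ⟩
    2 * a + 0                           ≡⟨ +-identityʳ (2 * a) ⟩
    2 * a                               ∎
    where
    open ≈-Reasoning
    regroup : ∀ a b c b′ c′ → a + b + c′ + (a + c + b′) ≡ 2 * a + (b + b′) + (c + c′)
    regroup = solve-∀

  +-cancelʳ : ∀ {a b} c → a + c ≈ b + c → a ≈ b
  +-cancelʳ {a} {b} c a+c≈b+c = begin
    a                     ≈⟨ m+n-n≈m a c ⟨
    a + c + neg c         ≈⟨ +-congʳ (neg c) a+c≈b+c ⟩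
    b + c + neg c         ≈⟨ m+n-n≈m b c ⟩
    b                     ∎
    where open ≈-Reasoning

  +-cancelˡ : ∀ a {b c} → a + b ≈ a + c → b ≈ c
  +-cancelˡ a {b} {c} a+b≈a+c = +-cancelʳ a (subst₂ _≈_ (+-comm a b) (+-comm a c) a+b≈a+c)

  *-cancelʳ-invertible : ∀ {u v} → u * v ≈ 1 → ∀ {a b} → a * u ≈ b * u → a ≈ b
  *-cancelʳ-invertible {u} {v} uv≈1 {a} {b} au≈bu = begin
    a                     ≡⟨ *-identityʳ a ⟨
    a * 1                 ≈⟨ *-congˡ a (≈-sym uv≈1) ⟩
    a * (u * v)           ≡⟨ *-assoc a u v ⟨
    a * u * v             ≈⟨ *-congʳ v au≈bu ⟩
    b * u * v             ≡⟨ *-assoc b u v ⟩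
    b * (u * v)           ≈⟨ *-congˡ b uv≈1 ⟩
    b * 1                 ≡⟨ *-identityʳ b ⟩
    b                     ∎
    where open ≈-Reasoning

  inverse : ∀ {u} → Coprime u m → ∃ λ v → u * v ≈ 1
  inverse {u} u⊥m with coprime-Bézout u⊥m
  ... | Bézout.+- x y 1+ym≡xu = x , (begin
    u * x                 ≡⟨ *-comm u x ⟩
    x * u                 ≡⟨ 1+ym≡xu ⟨
    1 + y * m             ≈⟨ +-congˡ 1 (*m≈0 y) ⟩
    1 + 0                 ∎)
    where open ≈-Reasoning
  ... | Bézout.-+ x y 1+xu≡ym = neg x , +-cancelʳ (u * x) (begin
    u * neg x + u * x     ≡⟨ *-distribˡ-+ u (neg x) x ⟨
    u * (neg x + x)       ≈⟨ *-congˡ u (≈-trans (≡⇒≈ (+-comm (neg x) x)) (+-inverseʳ x)) ⟩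
    u * 0                 ≡⟨ *-zeroʳ u ⟩
    0                     ≈⟨ *m≈0 y ⟨
    y * m                 ≡⟨ 1+xu≡ym ⟨
    1 + x * u             ≡⟨ cong (1 +_) (*-comm x u) ⟩
    1 + u * x             ∎)
    where open ≈-Reasoning

%-*-cancelʳ : ∀ {a b} L g .{{_ : NonZero L}} .{{_ : NonZero g}} .{{_ : NonZero (L * g)}} →
              (a * g) % (L * g) ≡ (b * g) % (L * g) → a % L ≡ b % L
%-*-cancelʳ {a} {b} L g eq =
  *-cancelʳ-≡ (a % L) (b % L) g (trans (m%n*o≡m*o%[n*o] a L g) (trans eq (sym (m%n*o≡m*o%[n*o] b L g))))

[2*m]%[2*n]≡2*[m%n] : ∀ a L .{{_ : NonZero L}} .{{_ : NonZero (2 * L)}} → (2 * a) % (2 * L) ≡ 2 * (a % L)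
[2*m]%[2*n]≡2*[m%n] a L = begin
  (2 * a) % (2 * L)   ≡⟨ cong (_% (2 * L)) (*-comm 2 a) ⟩
  (a * 2) % (2 * L)   ≡⟨ %-congʳ (*-comm 2 L) ⟩
  (a * 2) % (L * 2)   ≡⟨ m%n*o≡m*o%[n*o] a L 2 ⟨
  a % L * 2           ≡⟨ *-comm (a % L) 2 ⟩
  2 * (a % L)         ∎
  where
  open ≡-Reasoning
  instance _ = m*n≢0 L 2

m<n+n⇒m≡m%n⊎m≡m%n+n : ∀ {s M} .{{_ : NonZero M}} → s < M + M → s ≡ s % M ⊎ s ≡ s % M + M
m<n+n⇒m≡m%n⊎m≡m%n+n {s} {M} s<M+M
  with s / M | m≡m%n+[m/n]*n s M | m<n*o⇒m/o<n {s} {2} {M} (subst (s <_) (cong (M +_) (sym (+-identityʳ M))) s<M+M)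
... | zero        | s≡ | _ = inj₁ (trans s≡ (+-identityʳ (s % M)))
... | suc zero    | s≡ | _ = inj₂ (trans s≡ (cong (s % M +_) (+-identityʳ M)))
... | suc (suc _) | _  | s≤s (s≤s ())

m∣n∧n<m+m⇒n≡0⊎n≡m : ∀ {d s} → d ∣ s → s < d + d → s ≡ 0 ⊎ s ≡ d
m∣n∧n<m+m⇒n≡0⊎n≡m {d} (divides zero refl) _ = inj₁ refl
m∣n∧n<m+m⇒n≡0⊎n≡m {d} (divides (suc zero) refl) _ = inj₂ (+-identityʳ d)
m∣n∧n<m+m⇒n≡0⊎n≡m {d} (divides (suc (suc q)) refl) s<d+d =
  contradiction (+-monoʳ-≤ d (m≤m+n d (q * d))) (<⇒≱ s<d+d)

2*n≡n+n : ∀ n → 2 * n ≡ n + n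
2*n≡n+n n = cong (n +_) (+-identityʳ n)

-- Parity

isOdd : ℕ → Bool
isOdd zero    = false
isOdd (suc n) = not (isOdd n)

isOdd-+ : ∀ a b → isOdd (a + b) ≡ isOdd a xor isOdd b
isOdd-+ zero    b = refl
isOdd-+ (suc a) b = trans (cong not (isOdd-+ a b)) (not-distribˡ-xor (isOdd a) (isOdd b))

isOdd-2* : ∀ q → isOdd (2 * q) ≡ false
isOdd-2* q = begin
  isOdd (2 * q)                ≡⟨ cong isOdd (2*n≡n+n q) ⟩
  isOdd (q + q)                ≡⟨ isOdd-+ q q ⟩
  isOdd q xor isOdd q          ≡⟨ xor-same (isOdd q) ⟩
  false                        ∎
  where open ≡-Reasoning

isOdd-1+2* : ∀ q → isOdd (1 + 2 * q) ≡ true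
isOdd-1+2* q = cong not (isOdd-2* q)

isOdd-1+2*≢isOdd-2* : ∀ q r → isOdd (1 + 2 * q) ≢ isOdd (2 * r)
isOdd-1+2*≢isOdd-2* q r eq = contradiction (trans (sym (isOdd-1+2* q)) (trans eq (isOdd-2* r))) λ ()

data EvenOrOdd : ℕ → Set where
  even : ∀ q → EvenOrOdd (2 * q)
  odd  : ∀ q → EvenOrOdd (1 + 2 * q)

evenOrOdd : ∀ n → EvenOrOdd n
evenOrOdd zero = even 0
evenOrOdd (suc n) with evenOrOdd n
... | even q = odd q
... | odd q  = subst EvenOrOdd (cong suc (+-suc q (q + 0))) (even (suc q))

2∣⇒isOdd≡false : ∀ {a} → 2 ∣ a → isOdd a ≡ false
2∣⇒isOdd≡false (divides q refl) = trans (cong isOdd (*-comm q 2)) (isOdd-2* q)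

isOdd≡false⇒2∣ : ∀ {a} → isOdd a ≡ false → 2 ∣ a
isOdd≡false⇒2∣ {a} a-even with evenOrOdd a
... | even q = divides q (*-comm 2 q)
... | odd q  = contradiction (trans (sym (isOdd-1+2* q)) a-even) λ ()

2∤1+2* : ∀ q → ¬ 2 ∣ 1 + 2 * q
2∤1+2* q 2∣1+2q = contradiction (trans (sym (isOdd-1+2* q)) (2∣⇒isOdd≡false 2∣1+2q)) λ ()

2-valuation : ∀ m → .{{NonZero m}} → ∃ λ s → 2 ^ s ∣ m × ¬ 2 ^ suc s ∣ m
2-valuation = <-rec _ step
  where
  step : ∀ m → (∀ {k} → k < m → .{{NonZero k}} → ∃ λ s → 2 ^ s ∣ k × ¬ 2 ^ suc s ∣ k) →
         .{{NonZero m}} → ∃ λ s → 2 ^ s ∣ m × ¬ 2 ^ suc s ∣ m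
  step m rec with evenOrOdd m
  ... | odd q  = 0 , 1∣ _ , 2∤1+2* q
  ... | even q@(suc _) with rec {q} (m<m+n q (s≤s z≤n))
  ...   | s , 2^s∣q , 2^1+s∤q = suc s , *-monoʳ-∣ 2 2^s∣q , 2^1+s∤q ∘ *-cancelˡ-∣ 2

-- Additive order

gcd-nonZero : ∀ m n .{{_ : NonZero m}} → NonZero (gcd m n)
gcd-nonZero m n = ≢-nonZero (gcd[m,n]≢0 m n (inj₁ (≢-nonZero⁻¹ m)))

order : (p : ℕ) .{{_ : NonZero p}} → ℕ → ℕ
order p m = _/_ p (gcd p m) {{gcd-nonZero p m}}

order-*ʳ : ∀ {p} m c .{{_ : NonZero p}} .{{_ : NonZero c}} .{{_ : NonZero (p * c)}} →
           order (p * c) (m * c) ≡ order p m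
order-*ʳ {p} m c = begin
  p * c / gcd (p * c) (m * c)   ≡⟨ /-congʳ gcd-*ʳ ⟩
  p * c / (c * gcd p m)         ≡⟨ /-congˡ {o = c * gcd p m} (*-comm p c) ⟩
  c * p / (c * gcd p m)         ≡⟨ m*n/m*o≡n/o c p (gcd p m) ⟩
  p / gcd p m                   ∎
  where
  open ≡-Reasoning
  instance
    _ = gcd-nonZero p m
    _ = gcd-nonZero (p * c) (m * c)
    _ = m*n≢0 c (gcd p m)
  gcd-*ʳ : gcd (p * c) (m * c) ≡ c * gcd p m
  gcd-*ʳ = trans (cong₂ gcd (*-comm p c) (*-comm m c)) (sym (c*gcd[m,n]≡gcd[cm,cn] c p m))

2∣order⇒2∣ : ∀ {p} .{{_ : NonZero p}} m → 2 ∣ order p m → 2 ∣ p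
2∣order⇒2∣ {p} m 2∣order = subst (2 ∣_) (m/n*n≡m (gcd[m,n]∣m p m)) (∣m⇒∣m*n (gcd p m) 2∣order)
  where instance _ = gcd-nonZero p m

2∣order⇒∤ : ∀ {p m} .{{_ : NonZero p}} → 2 ∣ order p m → ¬ p ∣ m
2∣order⇒∤ {p} {m} 2∣order p∣m = contradiction (∣1⇒≡1 (subst (2 ∣_) order≡1 2∣order)) λ ()
  where
  instance _ = gcd-nonZero p m
  order≡1 : order p m ≡ 1
  order≡1 = trans (/-congʳ (∣-antisym (gcd[m,n]∣m p m) (gcd-greatest ∣-refl p∣m))) (n/n≡1 p)

2^s∣m∧2∣order⇒2^1+s∣ : ∀ s {p m} .{{_ : NonZero p}} → 2 ^ s ∣ m → 2 ∣ order p m → 2 ^ suc s ∣ p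
2^s∣m∧2∣order⇒2^1+s∣ zero {p} {m} _ 2∣order = 2∣order⇒2∣ m 2∣order
2^s∣m∧2∣order⇒2^1+s∣ (suc s) {p} {m} 2^1+s∣m 2∣order
  with divides p′ refl ← 2∣order⇒2∣ m 2∣order
     | divides m′ refl ← m*n∣⇒m∣ 2 (2 ^ s) 2^1+s∣m =
  subst (_∣ p′ * 2) (*-comm (2 ^ suc s) 2) (*-monoˡ-∣ 2 2^1+s∣p′)
  where
  instance _ = m*n≢0⇒m≢0 p′
  2^s∣m′ : 2 ^ s ∣ m′
  2^s∣m′ = *-cancelʳ-∣ 2 (subst (_∣ m′ * 2) (*-comm 2 (2 ^ s)) 2^1+s∣m)
  2^1+s∣p′ : 2 ^ suc s ∣ p′
  2^1+s∣p′ = 2^s∣m∧2∣order⇒2^1+s∣ s 2^s∣m′ (subst (2 ∣_) (order-*ʳ {p′} m′ 2) 2∣order)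

-- Antiperiodic Boolean sequences

xor-cancelˡ : ∀ x {a b} → x xor a ≡ x xor b → a ≡ b
xor-cancelˡ false eq = eq
xor-cancelˡ true  eq = not-injective eq

Antiperiod : (ℕ → Bool) → ℕ → Set
Antiperiod G m = ∀ x → G (x + m) ≡ not (G x)

module _ {G : ℕ → Bool} where

  antiperiod-* : ∀ {m} → Antiperiod G m → ∀ j x → G (x + j * m) ≡ G x xor isOdd j
  antiperiod-* anti zero    x = trans (cong G (+-identityʳ x)) (sym (xor-identityʳ (G x)))
  antiperiod-* {m} anti (suc j) x = begin
    G (x + (m + j * m))     ≡⟨ cong G (+-assoc x m (j * m)) ⟨
    G (x + m + j * m)       ≡⟨ antiperiod-* anti j (x + m) ⟩
    G (x + m) xor isOdd j   ≡⟨ cong (_xor isOdd j) (anti x) ⟩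
    not (G x) xor isOdd j   ≡⟨ not-distribˡ-xor (G x) (isOdd j) ⟨
    not (G x xor isOdd j)   ≡⟨ not-distribʳ-xor (G x) (isOdd j) ⟩
    G x xor not (isOdd j)   ∎
    where open ≡-Reasoning

  antiperiod⇒≢ : ∀ {m} → Antiperiod G m → G 0 ≢ G m
  antiperiod⇒≢ anti G0≡Gm = not-¬ refl (trans G0≡Gm (anti 0))

  antiperiods-isOdd : ∀ {m₁ m₂} → Antiperiod G m₁ → Antiperiod G m₂ →
                      ∀ {a b} → a * m₁ ≡ b * m₂ → isOdd a ≡ isOdd b
  antiperiods-isOdd anti₁ anti₂ {a} {b} eq = xor-cancelˡ (G 0) (begin
    G 0 xor isOdd a   ≡⟨ antiperiod-* anti₁ a 0 ⟨
    G (a * _)         ≡⟨ cong G eq ⟩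
    G (b * _)         ≡⟨ antiperiod-* anti₂ b 0 ⟩
    G 0 xor isOdd b   ∎)
    where open ≡-Reasoning

  antiperiods-2^∣ : ∀ {a b} → Antiperiod G a → Antiperiod G b → ∀ j → 2 ^ j ∣ a → 2 ^ j ∣ b
  antiperiods-2^∣ _ _ zero _ = 1∣ _
  antiperiods-2^∣ anti-a anti-b (suc j) 2^1+j∣a
    with antiperiods-2^∣ anti-a anti-b j (m*n∣⇒n∣ 2 (2 ^ j) 2^1+j∣a)
  ... | divides q refl with evenOrOdd q | 2^1+j∣a
  ...   | even q′ | _ = divides q′ (regroup q′ (2 ^ j))
    where regroup : ∀ a b → 2 * a * b ≡ a * (2 * b)
          regroup = solve-∀
  ...   | odd q′ | divides r refl =
    contradiction (antiperiods-isOdd anti-a anti-b {1 + 2 * q′} {2 * r} (regroup q′ r (2 ^ j)))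
                  (isOdd-1+2*≢isOdd-2* q′ r)
    where regroup : ∀ a b c → (1 + 2 * a) * (b * (2 * c)) ≡ 2 * b * ((1 + 2 * a) * c)
          regroup = solve-∀

  antiperiods⇒SameMult2 : ∀ {a b} → Antiperiod G a → Antiperiod G b → SameMult2 a b
  antiperiods⇒SameMult2 anti-a anti-b j = antiperiods-2^∣ anti-a anti-b j , antiperiods-2^∣ anti-b anti-a j

  module _ {p} .{{_ : NonZero p}} (G-mod : G Preserves ModularArithmetic._≈_ p ⟶ _≡_) where

    antiperiod-period-isOdd : ∀ {m} → Antiperiod G m → ∀ {a b} → a * m ≡ b * p → isOdd a ≡ false
    antiperiod-period-isOdd anti {a} {b} eq = xor-cancelˡ (G 0) (begin
      G 0 xor isOdd a   ≡⟨ antiperiod-* anti a 0 ⟨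
      G (a * _)         ≡⟨ cong G eq ⟩
      G (b * p)         ≡⟨ G-mod (ModularArithmetic.*m≈0 p b) ⟩
      G 0               ≡⟨ xor-identityʳ (G 0) ⟨
      G 0 xor false     ∎)
      where open ≡-Reasoning

    antiperiod⇒2∣order : ∀ {m} → Antiperiod G m → 2 ∣ order p m
    antiperiod⇒2∣order {m} anti = isOdd≡false⇒2∣ (antiperiod-period-isOdd anti {p / g} {m / g} order*m≡m/g*p)
      where
      g = gcd p m
      instance _ = gcd-nonZero p m
      order*m≡m/g*p : p / g * m ≡ m / g * p
      order*m≡m/g*p = begin
        p / g * m               ≡⟨ cong (p / g *_) (m/n*n≡m (gcd[m,n]∣n p m)) ⟨
        p / g * (m / g * g)     ≡⟨ swap (p / g) (m / g) g ⟩
        m / g * (p / g * g)     ≡⟨ cong (m / g *_) (m/n*n≡m (gcd[m,n]∣m p m)) ⟩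
        m / g * p               ∎
        where
        open ≡-Reasoning
        swap : ∀ a b c → a * (b * c) ≡ b * (a * c)
        swap = solve-∀

bit : ℕ → ℕ → Bool
bit s x = isOdd (x / 2 ^ s)
  where instance _ = m^n≢0 2 s

module _ (s : ℕ) where
  private instance _ = m^n≢0 2 s

  bit-+ : ∀ x {m} → 2 ^ s ∣ m → bit s (x + m) ≡ bit s x xor isOdd (m / 2 ^ s)
  bit-+ x 2^s∣m = trans (cong isOdd (+-distrib-/-∣ʳ x 2^s∣m)) (isOdd-+ (x / 2 ^ s) _)

  bit-antiperiod : ∀ {m} → 2 ^ s ∣ m → ¬ 2 ^ suc s ∣ m → Antiperiod (bit s) m
  bit-antiperiod {m} 2^s∣m 2^1+s∤m x = begin
    bit s (x + m)                     ≡⟨ bit-+ x 2^s∣m ⟩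
    bit s x xor isOdd (m / 2 ^ s)     ≡⟨ cong (bit s x xor_) quotient-odd ⟩
    bit s x xor true                  ≡⟨ xor-comm (bit s x) true ⟩
    not (bit s x)                     ∎
    where
    open ≡-Reasoning
    quotient-odd : isOdd (m / 2 ^ s) ≡ true
    quotient-odd = ¬-not λ even →
      2^1+s∤m (subst (_∣ m) (*-comm (2 ^ s) 2) (m∣n/o⇒o*m∣n 2^s∣m (isOdd≡false⇒2∣ even)))

  bit-mod : ∀ {p} .{{_ : NonZero p}} → 2 ^ suc s ∣ p → bit s Preserves ModularArithmetic._≈_ p ⟶ _≡_
  bit-mod {p} 2^1+s∣p {x} {y} x≈y = begin
    bit s x         ≡⟨ reduce x ⟩
    bit s (x % p)   ≡⟨ cong (bit s) x≈y ⟩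
    bit s (y % p)   ≡⟨ reduce y ⟨
    bit s y         ∎
    where
    open ≡-Reasoning
    reduce : ∀ z → bit s z ≡ bit s (z % p)
    reduce z = begin
      bit s z                                     ≡⟨ cong (bit s) (m≡m%n+[m/n]*n z p) ⟩
      bit s (z % p + z / p * p)                   ≡⟨ bit-+ (z % p) 2^s∣[z/p]*p ⟩
      bit s (z % p) xor isOdd (z / p * p / 2 ^ s) ≡⟨ cong (bit s (z % p) xor_) (2∣⇒isOdd≡false 2∣[z/p]*p/2^s) ⟩
      bit s (z % p) xor false                     ≡⟨ xor-identityʳ _ ⟩
      bit s (z % p)                               ∎
      where
      2^s∣[z/p]*p : 2 ^ s ∣ z / p * p
      2^s∣[z/p]*p = ∣-trans (m*n∣⇒n∣ 2 (2 ^ s) 2^1+s∣p) (n∣m*n (z / p))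
      2∣[z/p]*p/2^s : 2 ∣ z / p * p / 2 ^ s
      2∣[z/p]*p/2^s = m*n∣o⇒m∣o/n 2 (2 ^ s) (∣n⇒∣m*n (z / p) 2^1+s∣p)

-- Proper 2-colourings of sum graphs on ℤ/N

straddle : ∀ {a b c} → a + b ≡ c + c → a ≢ b → a < c × c < b ⊎ b < c × c < a
straddle {a} {b} {c} a+b≡c+c a≢b with <-cmp a c
... | tri< a<c _ _ = inj₁ (a<c , +-cancelˡ-< c c b (subst (_< c + b) a+b≡c+c (+-monoˡ-< b a<c)))
... | tri≈ _ refl _ = contradiction (sym (+-cancelˡ-≡ a b a a+b≡c+c)) a≢b
... | tri> _ _ c<a = inj₂ (+-cancelˡ-< c b c (subst (c + b <_) a+b≡c+c (+-monoˡ-< b c<a)) , c<a)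

straddle-<? : ∀ {a b c} → a + b ≡ c + c → a ≢ b → does (a <? c) ≢ does (b <? c)
straddle-<? {a} {b} {c} a+b≡c+c a≢b with straddle a+b≡c+c a≢b
... | inj₁ (a<c , c<b) rewrite dec-true (a <? c) a<c | dec-false (b <? c) (<⇒≯ c<b) = λ ()
... | inj₂ (b<c , c<a) rewrite dec-false (a <? c) (<⇒≯ c<a) | dec-true (b <? c) b<c = λ ()

module _ (L : ℕ) where

  arc : ℕ → Bool
  arc y = does (1 ≤? y) ∧ does (y ≤? L)

  arc-inside : ∀ {y} → 1 ≤ y → y ≤ L → arc y ≡ true
  arc-inside {y} 1≤y y≤L rewrite dec-true (1 ≤? y) 1≤y | dec-true (y ≤? L) y≤L = refl

  arc-beyond : ∀ {y} → L < y → arc y ≡ false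
  arc-beyond {y} L<y rewrite dec-false (y ≤? L) (<⇒≱ L<y) = ∧-zeroʳ _

  arc-below-above : ∀ {y y′ c} → 2 ≤ L → y′ < L + L → y + y′ ≡ c + c → y < c → c < y′ →
                    c ≡ 1 ⊎ L ≤ c × c ≤ suc L → arc y ≢ arc y′
  arc-below-above {zero} 2≤L _ refl _ _ (inj₁ refl) arc0≡arc2 =
    contradiction (trans arc0≡arc2 (arc-inside (s≤s z≤n) 2≤L)) λ ()
  arc-below-above {suc _} _ _ _ (s≤s ()) _ (inj₁ refl)
  arc-below-above {zero} {y′} _ y′<L+L y′≡c+c _ _ (inj₂ (L≤c , _)) =
    contradiction (subst (L + L ≤_) (sym y′≡c+c) (+-mono-≤ L≤c L≤c)) (<⇒≱ y′<L+L)
  arc-below-above {suc y} _ _ _ y<c c<y′ (inj₂ (L≤c , c≤1+L))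
    rewrite arc-inside (s≤s z≤n) (≤-pred (<-≤-trans y<c c≤1+L)) | arc-beyond (<-≤-trans (s≤s L≤c) c<y′) = λ ()

  arc-straddle : ∀ {y y′ c} → 2 ≤ L → y < L + L → y′ < L + L → y ≢ y′ → y + y′ ≡ c + c →
                 c ≡ 0 ⊎ c ≡ 1 ⊎ L ≤ c × c ≤ suc L → arc y ≢ arc y′
  arc-straddle {y} {y′} 2≤L y<L+L y′<L+L y≢y′ y+y′≡c+c c-cases with straddle y+y′≡c+c y≢y′ | c-cases
  ... | inj₁ (() , _) | inj₁ refl
  ... | inj₂ (() , _) | inj₁ refl
  ... | inj₁ (y<c , c<y′) | inj₂ c-cases′ = arc-below-above 2≤L y′<L+L y+y′≡c+c y<c c<y′ c-cases′
  ... | inj₂ (y′<c , c<y) | inj₂ c-cases′ =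
    ≢-sym (arc-below-above 2≤L y<L+L (trans (+-comm y′ y) y+y′≡c+c) y′<c c<y c-cases′)

≢∧<⇒2≤ : ∀ {i i′ L} → i < L → i′ < L → i ≢ i′ → 2 ≤ L
≢∧<⇒2≤ {suc _} i<L _ _ = ≤-trans (s≤s (s≤s z≤n)) i<L
≢∧<⇒2≤ {zero} {suc _} _ i′<L _ = ≤-trans (s≤s (s≤s z≤n)) i′<L
≢∧<⇒2≤ {zero} {zero} _ _ 0≢0 = contradiction refl 0≢0

module _ (L : ℕ) .{{_ : NonZero L}} where
  private
    instance _ = m*n≢0 2 L
    module ≈ᴸ = ModularArithmetic L
    module ≈²ᴸ = ModularArithmetic (2 * L)

  sum-centre : ∀ {S} → S < 2 * L + 2 * L → S % (2 * L) ≡ 0 ⊎ S % (2 * L) ≡ 2 →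
               ∃ λ c → S ≡ c + c × (c ≡ 0 ⊎ c ≡ 1 ⊎ L ≤ c × c ≤ suc L)
  sum-centre {S} S<4L r≡0⊎2 with r≡0⊎2 | m<n+n⇒m≡m%n⊎m≡m%n+n {M = 2 * L} S<4L
  ... | inj₁ r≡0 | inj₁ S≡r = 0 , trans S≡r r≡0 , inj₁ refl
  ... | inj₁ r≡0 | inj₂ S≡r+2L =
    L , trans S≡r+2L (trans (cong (_+ 2 * L) r≡0) (2*n≡n+n L)) , inj₂ (inj₂ (≤-refl , n≤1+n L))
  ... | inj₂ r≡2 | inj₁ S≡r = 1 , trans S≡r r≡2 , inj₂ (inj₁ refl)
  ... | inj₂ r≡2 | inj₂ S≡r+2L =
    suc L , trans S≡r+2L (trans (cong₂ _+_ r≡2 (2*n≡n+n L)) (cong suc (sym (+-suc L L)))) ,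
    inj₂ (inj₂ (n≤1+n L , ≤-refl))

  arc-proper : ∀ {y y′} → 2 ≤ L → y < L + L → y′ < L + L → y ≢ y′ →
               (y + y′) % (2 * L) ≡ 0 ⊎ (y + y′) % (2 * L) ≡ 2 → arc L y ≢ arc L y′
  arc-proper {y} {y′} 2≤L y<L+L y′<L+L y≢y′ r≡0⊎2 =
    let _ , y+y′≡c+c , c-cases = sum-centre y+y′<4L r≡0⊎2
    in  arc-straddle L 2≤L y<L+L y′<L+L y≢y′ y+y′≡c+c c-cases
    where
    y+y′<4L : y + y′ < 2 * L + 2 * L
    y+y′<4L = subst (y + y′ <_) (cong₂ _+_ (sym (2*n≡n+n L)) (sym (2*n≡n+n L))) (+-mono-< y<L+L y′<L+L)

  -- In ℤ/L the edges i + i′ ≡ -t and i + i′ ≡ 1 - t form a path; the coordinate y = 2i + t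
  -- (mod 2L) turns them into the reflections y ↦ -y and y ↦ 2 - y of ℤ/2L.
  zigzag : ℕ → ℕ → Bool
  zigzag t i = arc L ((2 * i + t) % (2 * L))

  zigzag-proper : ∀ {t i i′} → i < L → i′ < L → i ≢ i′ →
                  i + i′ + t ≈ᴸ.≈ 0 ⊎ i + i′ + t ≈ᴸ.≈ 1 → zigzag t i ≢ zigzag t i′
  zigzag-proper {t} {i} {i′} i<L i′<L i≢i′ sum≈ = arc-proper 2≤L (y< i) (y< i′) y≢y′ (Sum.map S≡0 S≡2 sum≈)
    where
    2≤L = ≢∧<⇒2≤ i<L i′<L i≢i′
    y : ℕ → ℕ
    y k = (2 * k + t) % (2 * L)
    y< : ∀ k → y k < L + L
    y< k = subst (y k <_) (2*n≡n+n L) (m%n<n (2 * k + t) (2 * L))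
    y≢y′ : y i ≢ y i′
    y≢y′ yi≡yi′ =
      i≢i′ (*-cancelˡ-≡ i i′ 2 (≈²ᴸ.≈⇒≡ (*-monoʳ-< 2 i<L) (*-monoʳ-< 2 i′<L) (≈²ᴸ.+-cancelʳ t yi≡yi′)))
    S%2L : (y i + y i′) % (2 * L) ≡ 2 * ((i + i′ + t) % L)
    S%2L = begin
      (y i + y i′) % (2 * L)               ≡⟨ ≈²ᴸ.+-cong (≈²ᴸ.%-≈ (2 * i + t)) (≈²ᴸ.%-≈ (2 * i′ + t)) ⟩
      (2 * i + t + (2 * i′ + t)) % (2 * L) ≡⟨ cong (_% (2 * L)) (regroup i i′ t) ⟩
      (2 * (i + i′ + t)) % (2 * L)         ≡⟨ [2*m]%[2*n]≡2*[m%n] (i + i′ + t) L ⟩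
      2 * ((i + i′ + t) % L)               ∎
      where
      open ≡-Reasoning
      regroup : ∀ a b c → 2 * a + c + (2 * b + c) ≡ 2 * (a + b + c)
      regroup = solve-∀
    S≡0 : i + i′ + t ≈ᴸ.≈ 0 → (y i + y i′) % (2 * L) ≡ 0
    S≡0 ≈0 = trans S%2L (cong (2 *_) (trans ≈0 ≈ᴸ.0%m≡0))
    S≡2 : i + i′ + t ≈ᴸ.≈ 1 → (y i + y i′) % (2 * L) ≡ 2
    S≡2 ≈1 = trans S%2L (cong (2 *_) (trans ≈1 (m<n⇒m%n≡m 2≤L)))

module _ (N : ℕ) .{{_ : NonZero N}} where
  open ModularArithmetic N

  ProperColouring : ℕ → ℕ → (ℕ → Bool) → Set
  ProperColouring s₁ s₂ h = ∀ {a b} → a < N → b < N → a ≢ b → a + b ≈ s₁ ⊎ a + b ≈ s₂ → h a ≢ h b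

  proper-shift : ∀ {s₁ s₂ t₁ t₂ h} c → t₁ + 2 * c ≈ s₁ → t₂ + 2 * c ≈ s₂ → ProperColouring s₁ s₂ h →
                 ProperColouring t₁ t₂ (λ a → h ((a + c) % N))
  proper-shift {s₁} {s₂} {t₁} {t₂} c t₁≈ t₂≈ proper {a} {b} a<N b<N a≢b sum≈ =
    proper (m%n<n (a + c) N) (m%n<n (b + c) N) shifted-≢ (Sum.map (shifted-sum t₁≈) (shifted-sum t₂≈) sum≈)
    where
    shifted-≢ : (a + c) % N ≢ (b + c) % N
    shifted-≢ eq = a≢b (≈⇒≡ a<N b<N (+-cancelʳ c eq))
    shifted-sum : ∀ {t s} → t + 2 * c ≈ s → a + b ≈ t → (a + c) % N + (b + c) % N ≈ s
    shifted-sum {t} {s} t≈s a+b≈t = begin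
      (a + c) % N + (b + c) % N   ≈⟨ +-cong (%-≈ (a + c)) (%-≈ (b + c)) ⟩
      a + c + (b + c)             ≡⟨ regroup a b c ⟩
      a + b + 2 * c               ≈⟨ +-congʳ (2 * c) a+b≈t ⟩
      t + 2 * c                   ≈⟨ t≈s ⟩
      s                           ∎
      where
      open ≈-Reasoning
      regroup : ∀ a b c → a + c + (b + c) ≡ a + b + 2 * c
      regroup = solve-∀

-- Write x = ρ + j·g with ρ < g.  Both reflections x ↦ -x and x ↦ δ - x send the residue ρ to
-- g - ρ (mod g), so residues with ρ ≢ g - ρ can be coloured by whether 2ρ < g.  The classes with
-- g ∣ 2ρ are closed under both reflections, and the index i = j·w mod L turns their edges into
-- i + i′ + (2ρ/g)·w ≡ 0 or 1 (mod L).
module CosetColouring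
  {N δ L g u w : ℕ} .{{_ : NonZero N}} .{{_ : NonZero L}} .{{_ : NonZero g}}
  (L*g≡N : L * g ≡ N) (u*g≡δ : u * g ≡ δ) (u*w≈1 : ModularArithmetic._≈_ L (u * w) 1)
  where

  open ModularArithmetic N

  private
    instance _ = m*n≢0 L g
    module ≈ᴸ = ModularArithmetic L

    g∣N : g ∣ N
    g∣N = divides L (sym L*g≡N)

    ρ : ℕ → ℕ
    ρ x = x % g

    j : ℕ → ℕ
    j x = x / g

    index : ℕ → ℕ
    index x = (j x * w) % L

  colour : ℕ → Bool
  colour x = if does (g ∣? 2 * ρ x) then zigzag L (2 * ρ x / g * w) (index x) else does (2 * ρ x <? g)

  private
    colour-g∣2ρ : ∀ x → g ∣ 2 * ρ x → colour x ≡ zigzag L (2 * ρ x / g * w) (index x)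
    colour-g∣2ρ x g∣2ρ rewrite dec-true (g ∣? 2 * ρ x) g∣2ρ = refl

    colour-g∤2ρ : ∀ x → ¬ g ∣ 2 * ρ x → colour x ≡ does (2 * ρ x <? g)
    colour-g∤2ρ x g∤2ρ rewrite dec-false (g ∣? 2 * ρ x) g∤2ρ = refl

    ρ+j*g : ∀ x → ρ x + j x * g ≡ x
    ρ+j*g x = sym (m≡m%n+[m/n]*n x g)

    j< : ∀ {x} → x < N → j x < L
    j< x<N = m<n*o⇒m/o<n (subst (_ <_) (sym L*g≡N) x<N)

    ρ,index-injective : ∀ {x y} → x < N → y < N → ρ x ≡ ρ y → index x ≡ index y → x ≡ y
    ρ,index-injective {x} {y} x<N y<N ρx≡ρy index≡ = begin
      x                 ≡⟨ ρ+j*g x ⟨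
      ρ x + j x * g     ≡⟨ cong₂ (λ r q → r + q * g) ρx≡ρy jx≡jy ⟩
      ρ y + j y * g     ≡⟨ ρ+j*g y ⟩
      y                 ∎
      where
      open ≡-Reasoning
      w*u≈1 : w * u ≈ᴸ.≈ 1
      w*u≈1 = trans (cong (_% L) (*-comm w u)) u*w≈1
      jx≡jy : j x ≡ j y
      jx≡jy = ≈ᴸ.≈⇒≡ (j< x<N) (j< y<N) (≈ᴸ.*-cancelʳ-invertible w*u≈1 index≡)

    g∣-≈ : ∀ {a s} → a ≈ s → g ∣ s → g ∣ a
    g∣-≈ {a} {s} a≈s g∣s = m%n≡0⇒n∣m a g (trans (%-divisor g∣N a≈s) (n∣m⇒m%n≡0 s g g∣s))

    g∣edge-sum : ∀ {a} → a ≈ 0 ⊎ a ≈ δ → g ∣ a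
    g∣edge-sum (inj₁ ≈0) = g∣-≈ ≈0 (g ∣0)
    g∣edge-sum (inj₂ ≈δ) = g∣-≈ ≈δ (divides u (sym u*g≡δ))

    *g≈⇒≈ᴸ : ∀ {a k s} → k * g ≡ s → a * g ≈ s → a ≈ᴸ.≈ k
    *g≈⇒≈ᴸ {a} {k} {s} k*g≡s a*g≈s = %-*-cancelʳ L g (begin
      a * g % (L * g)   ≡⟨ %-congʳ L*g≡N ⟩
      a * g % N         ≡⟨ a*g≈s ⟩
      s % N             ≡⟨ %-congʳ L*g≡N ⟨
      s % (L * g)       ≡⟨ cong (_% (L * g)) k*g≡s ⟨
      k * g % (L * g)   ∎)
      where open ≡-Reasoning

    ρ+ρ≡0⊎g : ∀ {x y} → x + y ≈ 0 ⊎ x + y ≈ δ → ρ x + ρ y ≡ 0 ⊎ ρ x + ρ y ≡ g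
    ρ+ρ≡0⊎g {x} {y} sum≈ = m∣n∧n<m+m⇒n≡0⊎n≡m g∣ρx+ρy (+-mono-< (m%n<n x g) (m%n<n y g))
      where
      x+y≡ : (j x + j y) * g + (ρ x + ρ y) ≡ x + y
      x+y≡ = trans (regroup (j x) (j y) (ρ x) (ρ y) g) (cong₂ _+_ (ρ+j*g x) (ρ+j*g y))
        where regroup : ∀ a b r s g → (a + b) * g + (r + s) ≡ r + a * g + (s + b * g)
              regroup = solve-∀
      g∣ρx+ρy : g ∣ ρ x + ρ y
      g∣ρx+ρy = ∣m+n∣m⇒∣n (subst (g ∣_) (sym x+y≡) (g∣edge-sum sum≈)) (n∣m*n (j x + j y))

    ρ≡ρ⇒g∣2ρ : ∀ {x y} → ρ x ≡ ρ y → x + y ≈ 0 ⊎ x + y ≈ δ → g ∣ 2 * ρ x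
    ρ≡ρ⇒g∣2ρ {x} {y} ρx≡ρy sum≈ = subst (g ∣_) ρx+ρy≡2ρx (g∣ρx+ρy (ρ+ρ≡0⊎g sum≈))
      where
      ρx+ρy≡2ρx : ρ x + ρ y ≡ 2 * ρ x
      ρx+ρy≡2ρx = trans (cong (ρ x +_) (sym ρx≡ρy)) (sym (2*n≡n+n (ρ x)))
      g∣ρx+ρy : ρ x + ρ y ≡ 0 ⊎ ρ x + ρ y ≡ g → g ∣ ρ x + ρ y
      g∣ρx+ρy (inj₁ ≡0) = subst (g ∣_) (sym ≡0) (g ∣0)
      g∣ρx+ρy (inj₂ ≡g) = subst (g ∣_) (sym ≡g) ∣-refl

    ρ≢ρ⇒ρ+ρ≡g : ∀ {x y} → ρ x ≢ ρ y → x + y ≈ 0 ⊎ x + y ≈ δ → ρ x + ρ y ≡ g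
    ρ≢ρ⇒ρ+ρ≡g {x} {y} ρx≢ρy sum≈ with ρ+ρ≡0⊎g sum≈
    ... | inj₂ ρx+ρy≡g = ρx+ρy≡g
    ... | inj₁ ρx+ρy≡0 =
      contradiction (trans (m+n≡0⇒m≡0 (ρ x) ρx+ρy≡0) (sym (m+n≡0⇒n≡0 (ρ x) ρx+ρy≡0))) ρx≢ρy

    ρ≢ρ⇒g∤2ρ : ∀ {x y} → ρ x ≢ ρ y → ρ x + ρ y ≡ g → ¬ g ∣ 2 * ρ x
    ρ≢ρ⇒g∤2ρ {x} {y} ρx≢ρy ρx+ρy≡g g∣2ρx
      with m∣n∧n<m+m⇒n≡0⊎n≡m g∣2ρx (subst (_< g + g) (sym (2*n≡n+n (ρ x))) (+-mono-< (m%n<n x g) (m%n<n x g)))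
    ... | inj₁ 2ρx≡0 = <⇒≢ (m%n<n y g) (trans (cong (_+ ρ y) (sym ρx≡0)) ρx+ρy≡g)
      where ρx≡0 = m+n≡0⇒m≡0 (ρ x) (trans (sym (2*n≡n+n (ρ x))) 2ρx≡0)
    ... | inj₂ 2ρx≡g = ρx≢ρy (+-cancelˡ-≡ (ρ x) (ρ x) (ρ y) (trans (sym (2*n≡n+n (ρ x))) (trans 2ρx≡g (sym ρx+ρy≡g))))

    edge-ρ≢ρ : ∀ {x y} → ρ x ≢ ρ y → ρ x + ρ y ≡ g → colour x ≢ colour y
    edge-ρ≢ρ {x} {y} ρx≢ρy ρx+ρy≡g
      rewrite colour-g∤2ρ x (ρ≢ρ⇒g∤2ρ ρx≢ρy ρx+ρy≡g)
            | colour-g∤2ρ y (ρ≢ρ⇒g∤2ρ (≢-sym ρx≢ρy) (trans (+-comm (ρ y) (ρ x)) ρx+ρy≡g)) =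
      straddle-<? {c = g} (trans (sym (*-distribˡ-+ 2 (ρ x) (ρ y))) (trans (cong (2 *_) ρx+ρy≡g) (2*n≡n+n g)))
                  (ρx≢ρy ∘ *-cancelˡ-≡ (ρ x) (ρ y) 2)

    same-residue-sum : ∀ {x y} → ρ x ≡ ρ y → g ∣ 2 * ρ x → x + y ≡ (2 * ρ x / g + j x + j y) * g
    same-residue-sum {x} {y} ρx≡ρy g∣2ρx = begin
      x + y                             ≡⟨ cong₂ _+_ (ρ+j*g x) (ρ+j*g y) ⟨
      ρ x + j x * g + (ρ y + j y * g)   ≡⟨ cong (λ r → ρ x + j x * g + (r + j y * g)) ρx≡ρy ⟨
      ρ x + j x * g + (ρ x + j y * g)   ≡⟨ regroup (ρ x) (j x) (j y) g ⟩
      2 * ρ x + (j x + j y) * g         ≡⟨ cong (_+ (j x + j y) * g) (m/n*n≡m g∣2ρx) ⟨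
      ε * g + (j x + j y) * g           ≡⟨ factor ε (j x) (j y) g ⟩
      (ε + j x + j y) * g               ∎
      where
      open ≡-Reasoning
      ε = 2 * ρ x / g
      regroup : ∀ r a b g → r + a * g + (r + b * g) ≡ 2 * r + (a + b) * g
      regroup = solve-∀
      factor : ∀ ε a b g → ε * g + (a + b) * g ≡ (ε + a + b) * g
      factor = solve-∀

    index-sum : ∀ x y ε → index x + index y + ε * w ≈ᴸ.≈ (ε + j x + j y) * w
    index-sum x y ε = begin
      index x + index y + ε * w   ≈⟨ ≈ᴸ.+-congʳ (ε * w) (≈ᴸ.+-cong (≈ᴸ.%-≈ (j x * w)) (≈ᴸ.%-≈ (j y * w))) ⟩
      j x * w + j y * w + ε * w   ≡⟨ factor (j x) (j y) ε w ⟩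
      (ε + j x + j y) * w         ∎
      where
      open ≈ᴸ.≈-Reasoning
      factor : ∀ a b ε w → a * w + b * w + ε * w ≡ (ε + a + b) * w
      factor = solve-∀

    edge-ρ≡ρ : ∀ {x y} → x < N → y < N → x ≢ y → ρ x ≡ ρ y → g ∣ 2 * ρ x →
               x + y ≈ 0 ⊎ x + y ≈ δ → colour x ≢ colour y
    edge-ρ≡ρ {x} {y} x<N y<N x≢y ρx≡ρy g∣2ρx sum≈
      rewrite colour-g∣2ρ x g∣2ρx | colour-g∣2ρ y (subst (λ r → g ∣ 2 * r) ρx≡ρy g∣2ρx) | sym ρx≡ρy =
      zigzag-proper L (m%n<n (j x * w) L) (m%n<n (j y * w) L) (x≢y ∘ ρ,index-injective x<N y<N ρx≡ρy)
                    (Sum.map (index-sum≈ {0} refl) (λ x+y≈δ → ≈ᴸ.≈-trans (index-sum≈ {u} u*g≡δ x+y≈δ) u*w≈1)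
                             sum≈)
      where
      ε = 2 * ρ x / g
      index-sum≈ : ∀ {k s} → k * g ≡ s → x + y ≈ s → index x + index y + ε * w ≈ᴸ.≈ k * w
      index-sum≈ {k} {s} k*g≡s x+y≈s =
        ≈ᴸ.≈-trans (index-sum x y ε)
                   (≈ᴸ.*-congʳ w (*g≈⇒≈ᴸ {ε + j x + j y} {k} k*g≡s
                                          (subst (_≈ s) (same-residue-sum ρx≡ρy g∣2ρx) x+y≈s)))

  colour-proper : ProperColouring N 0 δ colour
  colour-proper {x} {y} x<N y<N x≢y sum≈ with ρ x ≟ ρ y
  ... | yes ρx≡ρy = edge-ρ≡ρ x<N y<N x≢y ρx≡ρy (ρ≡ρ⇒g∣2ρ ρx≡ρy sum≈) sum≈
  ... | no ρx≢ρy  = edge-ρ≢ρ ρx≢ρy (ρ≢ρ⇒ρ+ρ≡g ρx≢ρy sum≈)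

module _ (N : ℕ) .{{_ : NonZero N}} where
  open ModularArithmetic N

  sum-graph-colouring : ∀ δ → ∃ (ProperColouring N 0 δ)
  sum-graph-colouring δ = colour , colour-proper
    where
    g = gcd N δ
    L = order N δ
    instance _ = gcd-nonZero N δ
    L*g≡N : L * g ≡ N
    L*g≡N = m/n*n≡m (gcd[m,n]∣m N δ)
    instance
      _ : NonZero L
      _ = ≢-nonZero λ L≡0 → ≢-nonZero⁻¹ N (trans (sym L*g≡N) (cong (_* g) L≡0))
    u⁻¹ = ModularArithmetic.inverse L (Coprimality.sym (coprime-/gcd N δ))
    open CosetColouring {N} {δ} {L} {g} {δ / g} {proj₁ u⁻¹} L*g≡N (m/n*n≡m (gcd[m,n]∣n N δ)) (proj₂ u⁻¹)

  even-sums-colouring : ∀ k₁ k₂ → ∃ (ProperColouring N (2 * k₁) (2 * k₂))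
  even-sums-colouring k₁ k₂ =
    _ , proper-shift N (neg k₁) 2k₁-2k₁≈0 refl (proj₂ (sum-graph-colouring (2 * k₂ + 2 * neg k₁)))
    where
    2k₁-2k₁≈0 : 2 * k₁ + 2 * neg k₁ ≈ 0
    2k₁-2k₁≈0 = ≈-trans (≡⇒≈ (sym (*-distribˡ-+ 2 k₁ (neg k₁)))) (*-congˡ 2 (+-inverseʳ k₁))

-- The dihedral group D_{2n}

both-values : ∀ {A : Set} (c : A → Bool) {x y} → c x ≢ c y → (∃ λ z → c z ≡ true) × (∃ λ z → c z ≡ false)
both-values c {x} {y} cx≢cy with c x in cx | c y in cy
... | true  | false = (x , cx) , (y , cy)
... | false | true  = (y , cy) , (x , cx)
... | true  | true  = contradiction refl cx≢cy
... | false | false = contradiction refl cx≢cy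

no-three-distinct : ∀ (a b c : Bool) → a ≢ b → a ≢ c → b ≢ c → ⊥
no-three-distinct true  true  _     a≢b _   _   = a≢b refl
no-three-distinct false false _     a≢b _   _   = a≢b refl
no-three-distinct true  false true  _   a≢c _   = a≢c refl
no-three-distinct true  false false _   _   b≢c = b≢c refl
no-three-distinct false true  true  _   _   b≢c = b≢c refl
no-three-distinct false true  false _   a≢c _   = a≢c refl

module Dihedral (n : ℕ) (hn : 2 ≤ n) where

  private
    N = 2 * n
    instance _ = nz n hn

  open ModularArithmetic N

  infixl 7 _·_
  _·_ : D n hn → D n hn → D n hn
  _·_ = mul n hn

  r^_ : ℕ → D n hn
  r^ a = rpow n hn a

  fr^_ : ℕ → D n hn
  fr^ a = ref (md n hn a)

  toℕ-md : ∀ a → toℕ (md n hn a) ≡ a % N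
  toℕ-md a = toℕ-fromℕ< (m%n<n a N)

  md-cong : ∀ {a b} → a ≈ b → md n hn a ≡ md n hn b
  md-cong {a} {b} a≈b = toℕ-injective (trans (toℕ-md a) (trans a≈b (sym (toℕ-md b))))

  md-injective : ∀ {a b} → md n hn a ≡ md n hn b → a ≈ b
  md-injective {a} {b} eq = trans (sym (toℕ-md a)) (trans (cong toℕ eq) (toℕ-md b))

  md-toℕ : ∀ i → md n hn (toℕ i) ≡ i
  md-toℕ i = toℕ-injective (trans (toℕ-md (toℕ i)) (m<n⇒m%n≡m (toℕ<n i)))

  rot-injective : ∀ {i i′ : Fin N} → Dih.rot i ≡ rot i′ → i ≡ i′
  rot-injective refl = refl

  ref-injective : ∀ {i i′ : Fin N} → Dih.ref i ≡ ref i′ → i ≡ i′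
  ref-injective refl = refl

  infix 4 _≟ᴰ_
  _≟ᴰ_ : DecidableEquality (D n hn)
  rot i ≟ᴰ rot i′ = Dec.map′ (cong rot) rot-injective (i Fin.≟ i′)
  ref i ≟ᴰ ref i′ = Dec.map′ (cong ref) ref-injective (i Fin.≟ i′)
  rot _ ≟ᴰ ref _ = no λ ()
  ref _ ≟ᴰ rot _ = no λ ()

  r^-cong : ∀ {a b} → a ≈ b → r^ a ≡ r^ b
  r^-cong = cong rot ∘ md-cong

  r^-injective : ∀ {a b} → r^ a ≡ r^ b → a ≈ b
  r^-injective = md-injective ∘ rot-injective

  fr^-cong : ∀ {a b} → a ≈ b → fr^ a ≡ fr^ b
  fr^-cong = cong ref ∘ md-cong

  fr^-injective : ∀ {a b} → fr^ a ≡ fr^ b → a ≈ b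
  fr^-injective = md-injective ∘ ref-injective

  rot≡r^toℕ : ∀ i → rot i ≡ r^ (toℕ i)
  rot≡r^toℕ i = cong rot (sym (md-toℕ i))

  ref≡fr^toℕ : ∀ i → ref i ≡ fr^ (toℕ i)
  ref≡fr^toℕ i = cong ref (sym (md-toℕ i))

  toℕ-md≈ : ∀ a → toℕ (md n hn a) ≈ a
  toℕ-md≈ a = ≈-trans (≡⇒≈ (toℕ-md a)) (%-≈ a)

  neg-toℕ-md : ∀ a → N ∸ toℕ (md n hn a) ≡ neg a
  neg-toℕ-md a = cong (N ∸_) (toℕ-md a)

  r^·r^ : ∀ a b → r^ a · r^ b ≡ r^ (a + b)
  r^·r^ a b = r^-cong (+-cong (toℕ-md≈ a) (toℕ-md≈ b))

  r^·fr^ : ∀ a b → r^ a · fr^ b ≡ fr^ (b + neg a)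
  r^·fr^ a b = fr^-cong (+-cong (toℕ-md≈ b) (≡⇒≈ (neg-toℕ-md a)))

  fr^·r^ : ∀ a b → fr^ a · r^ b ≡ fr^ (a + b)
  fr^·r^ a b = fr^-cong (+-cong (toℕ-md≈ a) (toℕ-md≈ b))

  fr^·fr^ : ∀ a b → fr^ a · fr^ b ≡ r^ (b + neg a)
  fr^·fr^ a b = r^-cong (+-cong (toℕ-md≈ b) (≡⇒≈ (neg-toℕ-md a)))

  fr^≢fr^+ : ∀ {a m} → m ≉ 0 → fr^ a ≢ fr^ (a + m)
  fr^≢fr^+ {a} m≉0 eq = m≉0 (≈-sym (+-cancelˡ a (≈-trans (≡⇒≈ (+-identityʳ a)) (fr^-injective eq))))

  1+2*≉0 : ∀ q → 1 + 2 * q ≉ 0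
  1+2*≉0 q 1+2q≈0 = 2∤1+2* q (∣-trans (m∣m*n n) (≈0⇒∣ 1+2q≈0))

  Avoids : SubsetD n hn → (D n hn → Bool) → Set
  Avoids V c = ∀ x y → x ≢ y → c x ≡ c y → V (x · y) ≡ false

  module Avoiding {V : SubsetD n hn} {c : D n hn → Bool} (avoids : Avoids V c) where

    colours-differ : ∀ {x y} → V (x · y) ≡ true → x ≢ y → c x ≢ c y
    colours-differ V∋xy x≢y cx≡cy = contradiction (trans (sym V∋xy) (avoids _ _ x≢y cx≡cy)) λ ()

    no-triangle : ∀ {x y z} → V (x · y) ≡ true → V (x · z) ≡ true → V (y · z) ≡ true →
                  x ≢ y → x ≢ z → y ≢ z → ⊥
    no-triangle V∋xy V∋xz V∋yz x≢y x≢z y≢z =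
      no-three-distinct _ _ _ (colours-differ V∋xy x≢y) (colours-differ V∋xz x≢z) (colours-differ V∋yz y≢z)

    reflection-colour : ℕ → Bool
    reflection-colour a = c (fr^ a)

    reflection-colour-mod : reflection-colour Preserves _≈_ ⟶ _≡_
    reflection-colour-mod = cong c ∘ fr^-cong

    reflection-colour-antiperiod : ∀ {m} → V (r^ m) ≡ true → m ≉ 0 → Antiperiod reflection-colour m
    reflection-colour-antiperiod {m} V∋r^m m≉0 x =
      ¬-not (≢-sym (colours-differ (trans (cong V (trans (fr^·fr^ x (x + m)) (r^-cong (m+n-m≈n x m)))) V∋r^m)
                                   (fr^≢fr^+ m≉0)))

    -- (f r^t) r^k = r^k (f r^(t+2k)) = f r^(t+k) and (f r^t)(f r^(t+2k)) = r^(2k).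
    no-reflection : ∀ {k} → V (r^ (2 * k)) ≡ true → 2 * k ≉ 0 → ∀ s → V (fr^ s) ≢ true
    no-reflection {k} V∋r^2k 2k≉0 s V∋fr^s = no-triangle {fr^ t} {r^ k} {fr^ (t + 2 * k)}
      (trans (cong V (trans (fr^·r^ t k) (fr^-cong t+k≈s))) V∋fr^s)
      (trans (cong V (trans (fr^·fr^ t (t + 2 * k)) (r^-cong (m+n-m≈n t (2 * k))))) V∋r^2k)
      (trans (cong V (trans (r^·fr^ k (t + 2 * k)) (fr^-cong t+2k-k≈s))) V∋fr^s)
      (λ ()) (fr^≢fr^+ 2k≉0) (λ ())
      where
      t = s + neg k
      t+k≈s : t + k ≈ s
      t+k≈s = m-n+n≈m s k
      t+2k-k≈s : t + 2 * k + neg k ≈ s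
      t+2k-k≈s = begin
        t + 2 * k + neg k     ≡⟨ cong (_+ neg k) (trans (cong (t +_) (2*n≡n+n k)) (sym (+-assoc t k k))) ⟩
        t + k + k + neg k     ≈⟨ m+n-n≈m (t + k) k ⟩
        t + k                 ≈⟨ t+k≈s ⟩
        s                     ∎
        where open ≈-Reasoning

    no-odd-rotation : ∀ {k} → V (r^ (2 * k)) ≡ true → 2 * k ≉ 0 → ∀ q → V (r^ (1 + 2 * q)) ≢ true
    no-odd-rotation {k} V∋r^2k 2k≉0 q V∋r^1+2q =
      isOdd-1+2*≢isOdd-2* q k (antiperiods-isOdd (reflection-colour-antiperiod {2 * k} V∋r^2k 2k≉0)
                                                   (reflection-colour-antiperiod V∋r^1+2q (1+2*≉0 q))
                                                   {1 + 2 * q} {2 * k} (*-comm (1 + 2 * q) (2 * k)))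

    no-three-even-rotations : ∀ {k₁ k₂ k₃} → V (r^ (2 * k₁)) ≡ true → V (r^ (2 * k₂)) ≡ true → V (r^ (2 * k₃)) ≡ true →
                              2 * k₁ ≉ 2 * k₂ → 2 * k₁ ≉ 2 * k₃ → 2 * k₂ ≉ 2 * k₃ → ⊥
    no-three-even-rotations {k₁} {k₂} {k₃} V∋₁ V∋₂ V∋₃ 1≉2 1≉3 2≉3 =
      no-triangle {r^ p₁} {r^ p₂} {r^ p₃}
        (trans (cong V (trans (r^·r^ p₁ p₂) (r^-cong p₁+p₂≈))) V∋₁)
        (trans (cong V (trans (r^·r^ p₁ p₃) (r^-cong p₁+p₃≈))) V∋₂)
        (trans (cong V (trans (r^·r^ p₂ p₃) (r^-cong p₂+p₃≈))) V∋₃)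
        (λ eq → 2≉3 (≈-trans (≈-sym p₁+p₃≈) (≈-trans (+-congʳ p₃ (r^-injective eq)) p₂+p₃≈)))
        (λ eq → 1≉3 (≈-trans (≈-sym p₁+p₂≈)
                             (≈-trans (+-congʳ p₂ (r^-injective eq)) (≈-trans (≡⇒≈ (+-comm p₃ p₂)) p₂+p₃≈))))
        (λ eq → 1≉2 (≈-trans (≈-sym p₁+p₂≈) (≈-trans (+-congˡ p₁ (r^-injective eq)) p₁+p₃≈)))
      where
      p₁ = k₁ + k₂ + neg k₃
      p₂ = k₁ + k₃ + neg k₂
      p₃ = k₂ + k₃ + neg k₁
      p₁+p₂≈ : p₁ + p₂ ≈ 2 * k₁
      p₁+p₂≈ = [m+n-o]+[m+o-n]≈2m k₁ k₂ k₃
      p₁+p₃≈ : p₁ + p₃ ≈ 2 * k₂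
      p₁+p₃≈ = ≈-trans (≡⇒≈ (cong (λ a → a + neg k₃ + p₃) (+-comm k₁ k₂))) ([m+n-o]+[m+o-n]≈2m k₂ k₁ k₃)
      p₂+p₃≈ : p₂ + p₃ ≈ 2 * k₃
      p₂+p₃≈ = ≈-trans (≡⇒≈ (cong₂ (λ a b → a + neg k₂ + (b + neg k₁)) (+-comm k₁ k₃) (+-comm k₂ k₃)))
                       ([m+n-o]+[m+o-n]≈2m k₃ k₁ k₂)

    even-rotation-pair-bound : ∀ {k l} → V (r^ (2 * k)) ≡ true → V (r^ (2 * l)) ≡ true → 2 * k ≉ 0 → 2 * k ≉ 2 * l →
                               ∀ x → V x ≡ true → x ≡ r^ (2 * k) ⊎ x ≡ r^ (2 * l)
    even-rotation-pair-bound {k} {l} V∋r^2k V∋r^2l 2k≉0 2k≉2l (ref i) V∋x =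
      contradiction (subst (λ x → V x ≡ true) (ref≡fr^toℕ i) V∋x) (no-reflection {k} V∋r^2k 2k≉0 (toℕ i))
    even-rotation-pair-bound {k} {l} V∋r^2k V∋r^2l 2k≉0 2k≉2l (rot i) V∋x
      rewrite rot≡r^toℕ i = rotation (toℕ i) V∋x
      where
      rotation : ∀ a → V (r^ a) ≡ true → r^ a ≡ r^ (2 * k) ⊎ r^ a ≡ r^ (2 * l)
      rotation a V∋r^a with evenOrOdd a
      ... | odd q  = contradiction V∋r^a (no-odd-rotation {k} V∋r^2k 2k≉0 q)
      ... | even q with (2 * q) % N ≟ (2 * k) % N | (2 * q) % N ≟ (2 * l) % N
      ...   | yes 2q≈2k | _ = inj₁ (r^-cong 2q≈2k)
      ...   | no _      | yes 2q≈2l = inj₂ (r^-cong 2q≈2l)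
      ...   | no 2q≉2k  | no 2q≉2l = contradiction V∋r^a λ V∋r^2q →
        no-three-even-rotations {k} {l} {q} V∋r^2k V∋r^2l V∋r^2q 2k≉2l (2q≉2k ∘ ≈-sym) (2q≉2l ∘ ≈-sym)

  Separates : (ℕ → Bool) → ℕ → Set
  Separates G m = ∀ {a b} → a ≉ b → b ≈ a + m → G a ≢ G b

  separates-0 : ∀ {G} → Separates G 0
  separates-0 {_} {a} a≉b b≈a+0 = contradiction (≈-sym (≈-trans b≈a+0 (≡⇒≈ (+-identityʳ a)))) a≉b

  antiperiod⇒separates : ∀ {G m} → G Preserves _≈_ ⟶ _≡_ → Antiperiod G m → Separates G m
  antiperiod⇒separates G-mod anti {a} _ b≈a+m Ga≡Gb = not-¬ refl (trans Ga≡Gb (trans (G-mod b≈a+m) (anti a)))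

  colouring : (ℕ → Bool) → (ℕ → Bool) → D n hn → Bool
  colouring h G (rot i) = h (toℕ i)
  colouring h G (ref i) = G (toℕ i)

  even-rotation-pair-avoidable : ∀ {V k₁ k₂ G} → (∀ x → V x ≡ true → x ≡ r^ (2 * k₁) ⊎ x ≡ r^ (2 * k₂)) →
    G Preserves _≈_ ⟶ _≡_ → Separates G (2 * k₁) → Antiperiod G (2 * k₂) → Avoidable n hn V
  even-rotation-pair-avoidable {V} {k₁} {k₂} {G} V⊆ G-mod separates₁ anti₂ =
    c , proj₁ both-colours , proj₂ both-colours , avoids
    where
    h,proper = even-sums-colouring N k₁ k₂
    c = colouring (proj₁ h,proper) G
    c-fr^ : ∀ a → c (fr^ a) ≡ G a
    c-fr^ a = G-mod (toℕ-md≈ a)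
    both-colours = both-values c {fr^ 0} {fr^ (2 * k₂)}
      λ eq → antiperiod⇒≢ anti₂ (trans (sym (c-fr^ 0)) (trans eq (c-fr^ (2 * k₂))))
    ref-edge : ∀ {m i i′} → Separates G m → ref i ≢ ref i′ → ref i · ref i′ ≡ r^ m → G (toℕ i) ≢ G (toℕ i′)
    ref-edge {m} {i} {i′} separates i≢i′ ii′≡r^m =
      separates (λ i≈i′ → i≢i′ (cong ref (toℕ-injective (≈⇒≡ (toℕ<n i) (toℕ<n i′) i≈i′))))
                (m-n≈o⇒m≈n+o (r^-injective (trans (sym (fr^·fr^ (toℕ i) (toℕ i′)))
                                                  (trans (sym (cong₂ _·_ (ref≡fr^toℕ i) (ref≡fr^toℕ i′))) ii′≡r^m))))
    edge : ∀ x y → x ≢ y → c x ≡ c y → x · y ≡ r^ (2 * k₁) ⊎ x · y ≡ r^ (2 * k₂) → ⊥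
    edge (rot i) (rot i′) x≢y cx≡cy xy≡ =
      proj₂ h,proper (toℕ<n i) (toℕ<n i′) (x≢y ∘ cong rot ∘ toℕ-injective)
                     (Sum.map r^-injective r^-injective xy≡) cx≡cy
    edge (rot _) (ref _) _ _ (inj₁ ())
    edge (rot _) (ref _) _ _ (inj₂ ())
    edge (ref _) (rot _) _ _ (inj₁ ())
    edge (ref _) (rot _) _ _ (inj₂ ())
    edge (ref i) (ref i′) x≢y cx≡cy (inj₁ xy≡) = ref-edge separates₁ x≢y xy≡ cx≡cy
    edge (ref i) (ref i′) x≢y cx≡cy (inj₂ xy≡) = ref-edge (antiperiod⇒separates G-mod anti₂) x≢y xy≡ cx≡cy
    avoids : Avoids V c
    avoids x y x≢y cx≡cy = ¬-not λ V∋xy → edge x y x≢y cx≡cy (V⊆ _ V∋xy)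

  EvenRotationPair : SubsetD n hn → ℕ → ℕ → Set
  EvenRotationPair U k l =
    r^ (2 * k) ≢ r^ (2 * l) ×
    2 ∣ ordQuot n hn (2 * k) × 2 ∣ ordQuot n hn (2 * l) ×
    SameMult2 (2 * k) (2 * l) ×
    (∀ x → U x ≡ true → x ≡ r^ (2 * k) ⊎ x ≡ r^ (2 * l)) ×
    (∀ x → x ≡ r^ (2 * k) ⊎ x ≡ r^ (2 * l) → U x ≡ true)

  module SaturatedSubset {U : SubsetD n hn} (saturated : Saturated n hn U)
                         {k : ℕ} (U∋r^2k : U (r^ (2 * k)) ≡ true) (U∌e : U (e n hn) ≡ false) where

    private
      c = proj₁ (proj₁ saturated)
      maximal = proj₂ saturated
    open Avoiding {U} {c} (proj₂ (proj₂ (proj₂ (proj₁ saturated))))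

    ≉0 : ∀ {m} → U (r^ m) ≡ true → m ≉ 0
    ≉0 U∋r^m m≈0 = contradiction (trans (sym U∋r^m) (trans (cong U (r^-cong m≈0)) U∌e)) λ ()

    anti-2k : Antiperiod reflection-colour (2 * k)
    anti-2k = reflection-colour-antiperiod U∋r^2k (≉0 U∋r^2k)

    second-rotation : ∀ {l} → U (r^ (2 * l)) ≡ true → 2 * k ≉ 2 * l → EvenRotationPair U k l
    second-rotation {l} U∋r^2l 2k≉2l =
      2k≉2l ∘ r^-injective ,
      antiperiod⇒2∣order {reflection-colour} reflection-colour-mod anti-2k ,
      antiperiod⇒2∣order {reflection-colour} reflection-colour-mod anti-2l ,
      antiperiods⇒SameMult2 anti-2k anti-2l ,
      even-rotation-pair-bound {k} {l} U∋r^2k U∋r^2l (≉0 U∋r^2k) 2k≉2l ,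
      λ { _ (inj₁ refl) → U∋r^2k ; _ (inj₂ refl) → U∋r^2l }
      where
      anti-2l : Antiperiod reflection-colour (2 * l)
      anti-2l = reflection-colour-antiperiod U∋r^2l (≉0 U∋r^2l)

    other-rotation : ∀ a → U (r^ a) ≡ true → r^ a ≢ r^ (2 * k) → ∃ λ k → ∃ λ l → EvenRotationPair U k l
    other-rotation a U∋r^a r^a≢r^2k with evenOrOdd a
    ... | odd q  = contradiction U∋r^a (no-odd-rotation {k} U∋r^2k (≉0 U∋r^2k) q)
    ... | even l = k , l , second-rotation {l} U∋r^a λ 2k≈2l → r^a≢r^2k (r^-cong (≈-sym 2k≈2l))

    module _ (U-only : ∀ i → U (rot i) ≡ true → rot i ≡ r^ (2 * k)) where

      U∪e : SubsetD n hn
      U∪e x = U x ∨ does (x ≟ᴰ e n hn)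

      U∪e-only : ∀ x → U∪e x ≡ true → x ≡ r^ (2 * 0) ⊎ x ≡ r^ (2 * k)
      U∪e-only x U∪e∋x with U x in U∋x | x ≟ᴰ e n hn
      U∪e-only (ref i) _ | true | _ =
        contradiction (subst (λ x → U x ≡ true) (ref≡fr^toℕ i) U∋x)
                      (no-reflection {k} U∋r^2k (≉0 U∋r^2k) (toℕ i))
      U∪e-only (rot i) _ | true | _ = inj₂ (U-only i U∋x)
      ... | false | yes x≡e = inj₁ x≡e

      U∪e-avoidable : Avoidable n hn U∪e
      U∪e-avoidable = even-rotation-pair-avoidable {U∪e} {0} {k} U∪e-only reflection-colour-mod separates-0 anti-2k

      U⊆U∪e : _⊆_ n hn U U∪e
      U⊆U∪e x U∋x rewrite U∋x = refl

      U∪e∋e : U∪e (e n hn) ≡ true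
      U∪e∋e = trans (cong (U (e n hn) ∨_) (dec-true (e n hn ≟ᴰ e n hn) refl)) (∨-zeroʳ (U (e n hn)))

      no-other-rotation : ⊥
      no-other-rotation =
        contradiction (trans (sym (maximal U∪e U∪e-avoidable U⊆U∪e (e n hn) U∪e∋e)) U∌e) λ ()

    even-rotation-pair : ∃ λ k → ∃ λ l → EvenRotationPair U k l
    even-rotation-pair with any? (λ i → (U (rot i) Bool.≟ true) ×-dec ¬? (rot i ≟ᴰ r^ (2 * k)))
    ... | yes (i , U∋rot-i , rot-i≢r^2k) =
      other-rotation (toℕ i) (subst (λ x → U x ≡ true) (rot≡r^toℕ i) U∋rot-i)
                     (rot-i≢r^2k ∘ trans (rot≡r^toℕ i))
    ... | no none = contradiction U-only no-other-rotation
      where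
      U-only : ∀ i → U (rot i) ≡ true → rot i ≡ r^ (2 * k)
      U-only i U∋rot-i =
        Dec.decidable-stable (rot i ≟ᴰ r^ (2 * k)) λ rot-i≢r^2k → none (i , U∋rot-i , rot-i≢r^2k)

  even-rotation-pair⇒saturated : ∀ {U k l} → EvenRotationPair U k l →
    Saturated n hn U × (∃ λ k → U (r^ (2 * k)) ≡ true) × U (e n hn) ≡ false
  even-rotation-pair⇒saturated {U} {k} {l} (r^2k≢r^2l , 2∣order-2k , 2∣order-2l , same-2-power , U-only , U∋) =
    (avoidable , maximal) , (k , U∋r^2k) , U∌e
    where
    U∋r^2k = U∋ (r^ (2 * k)) (inj₁ refl)
    U∋r^2l = U∋ (r^ (2 * l)) (inj₂ refl)
    2k≉0 : 2 * k ≉ 0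
    2k≉0 = 2∣order⇒∤ {N} 2∣order-2k ∘ ≈0⇒∣
    2l≉0 : 2 * l ≉ 0
    2l≉0 = 2∣order⇒∤ {N} 2∣order-2l ∘ ≈0⇒∣
    U∌e : U (e n hn) ≡ false
    U∌e = ¬-not λ U∋e → Sum.[ 2k≉0 ∘ ≈-sym ∘ r^-injective , 2l≉0 ∘ ≈-sym ∘ r^-injective ] (U-only _ U∋e)
    instance
      _ : NonZero (2 * k)
      _ = ≢-nonZero (2k≉0 ∘ ≡⇒≈)
    s = proj₁ (2-valuation (2 * k))
    2^s∣2k = proj₁ (proj₂ (2-valuation (2 * k)))
    2^1+s∤2k = proj₂ (proj₂ (2-valuation (2 * k)))
    bit-s-mod : bit s Preserves _≈_ ⟶ _≡_
    bit-s-mod = bit-mod s (2^s∣m∧2∣order⇒2^1+s∣ s 2^s∣2k 2∣order-2k)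
    anti-2k : Antiperiod (bit s) (2 * k)
    anti-2k = bit-antiperiod s 2^s∣2k 2^1+s∤2k
    anti-2l : Antiperiod (bit s) (2 * l)
    anti-2l = bit-antiperiod s (proj₁ (same-2-power s) 2^s∣2k) (2^1+s∤2k ∘ proj₂ (same-2-power (suc s)))
    avoidable : Avoidable n hn U
    avoidable = even-rotation-pair-avoidable {U} {k} {l} U-only bit-s-mod (antiperiod⇒separates bit-s-mod anti-2k) anti-2l
    maximal : ∀ V → Avoidable n hn V → _⊆_ n hn U V → _⊆_ n hn V U
    maximal V (_ , _ , _ , avoids) U⊆V x V∋x =
      U∋ x (Avoiding.even-rotation-pair-bound avoids {k} {l} (U⊆V _ U∋r^2k) (U⊆V _ U∋r^2l)
                                              2k≉0 (r^2k≢r^2l ∘ r^-cong) x V∋x)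

proposition4p5 : (n : ℕ) (hn : 2 ≤ n) (U : SubsetD n hn) →
    ((Saturated n hn U × (∃ λ k → U (rpow n hn (2 * k)) ≡ true) × U (e n hn) ≡ false)
      → Σ ℕ λ k → Σ ℕ λ l →
          rpow n hn (2 * k) ≢ rpow n hn (2 * l) ×
          2 ∣ ordQuot n hn (2 * k) × 2 ∣ ordQuot n hn (2 * l) ×
          SameMult2 (2 * k) (2 * l) ×
          (∀ x → U x ≡ true → x ≡ rpow n hn (2 * k) ⊎ x ≡ rpow n hn (2 * l)) ×
          (∀ x → x ≡ rpow n hn (2 * k) ⊎ x ≡ rpow n hn (2 * l) → U x ≡ true))
    × ((Σ ℕ λ k → Σ ℕ λ l →
          rpow n hn (2 * k) ≢ rpow n hn (2 * l) ×
          2 ∣ ordQuot n hn (2 * k) × 2 ∣ ordQuot n hn (2 * l) ×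
          SameMult2 (2 * k) (2 * l) ×
          (∀ x → U x ≡ true → x ≡ rpow n hn (2 * k) ⊎ x ≡ rpow n hn (2 * l)) ×
          (∀ x → x ≡ rpow n hn (2 * k) ⊎ x ≡ rpow n hn (2 * l) → U x ≡ true))
      → Saturated n hn U × (∃ λ k → U (rpow n hn (2 * k)) ≡ true) × U (e n hn) ≡ false)
proposition4p5 n hn U =
  (λ (saturated , (k , U∋r^2k) , U∌e) → SaturatedSubset.even-rotation-pair saturated {k} U∋r^2k U∌e) ,
  (λ (k , l , pair) → even-rotation-pair⇒saturated {U} {k} {l} pair)
  where open Dihedral n hn
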